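{- Let $n$ be a positive integer and let $\alpha$ be an interval $W(Q_n)$-coloring of $Q_n$. Then $\mathrm{sp}_{\alpha,n-1}\leq \frac{n(n+1)}{2}-1$.
   Context: All graphs are finite, undirected, without loops or multiple edges. An edge-coloring of a graph $G$ with colors $1,\ldots,t$ is an interval $t$-coloring if all $t$ colors are used, and the colors of the edges incident to each vertex are distinct and form an interval of consecutive integers; $W(G)$ is the greatest $t$ for which $G$ has an interval $t$-coloring. $Q_n$ is the $n$-dimensional hypercube (Cartesian product of $n$ copies of $K_2$), and $d(u,v)$ is the graph distance. For edges $e=u_1u_2$ and $e'=v_1v_2$ of $Q_n$, $d(e,e')=\min_{1\leq i,j\leq 2}d(u_i,v_j)$. For an interval coloring $\alpha$ of $Q_n$, $\mathrm{sp}_\alpha(e,e')=|\alpha(e)-\alpha(e')|$, and for $0\leq k\leq n-1$, $\mathrm{sp}_{\alpha,k}=\max\{\mathrm{sp}_\alpha(e,e')\colon e,e'\in E(Q_n),\ d(e,e')=k\}$. -}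

module Defs where

open import Data.Nat using (ℕ; zero; suc; _+_; _*_; _∸_; _≤_; _<_)
open import Data.Bool using (Bool; not)
open import Data.Fin using (Fin)
open import Data.Vec using (Vec; updateAt)
open import Data.Product using (Σ; ∃; ∃-syntax; _×_; _,_)
open import Data.Sum using (_⊎_)
open import Relation.Binary.PropositionalEquality using (_≡_; _≢_)

Vertex : ℕ → Set
Vertex n = Vec Bool n

-- Flip coordinate i.  Two vertices are adjacent in Q_n iff one is the
-- flip of the other in exactly one coordinate.
flip : ∀ {n} → Fin n → Vertex n → Vertex n
flip i v = updateAt v i not

-- Edges of Q_n: the edge {v , flip i v} is named by any pair (v , i);
-- (v , i) and (flip i v , i) name the same edge.
-- An edge colouring is thus a function on such pairs that takes the
-- same value on both names of an edge.
EdgeColouring : ℕ → Set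
EdgeColouring n = Vertex n → Fin n → ℕ

IsEdgeFunction : ∀ {n} → EdgeColouring n → Set
IsEdgeFunction {n} α = ∀ (v : Vertex n) (i : Fin n) → α v i ≡ α (flip i v) i

data Walk {n : ℕ} : Vertex n → Vertex n → ℕ → Set where
  here : ∀ {u} → Walk u u zero
  step : ∀ {u w k} (i : Fin n) → Walk (flip i u) w k → Walk u w (suc k)

Dist : ∀ {n} → Vertex n → Vertex n → ℕ → Set
Dist u w k = Walk u w k × (∀ m → Walk u w m → k ≤ m)

IsEnd : ∀ {n} → Vertex n → Fin n → Vertex n → Set
IsEnd v i x = (x ≡ v) ⊎ (x ≡ flip i v)

EdgeDist : ∀ {n} → Vertex n → Fin n → Vertex n → Fin n → ℕ → Set
EdgeDist v i w j k =
  (∃[ x ] ∃[ y ] (IsEnd v i x × IsEnd w j y × Dist x y k))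
  × (∀ x y m → IsEnd v i x → IsEnd w j y → Dist x y m → k ≤ m)

IsIntervalColouring : (n t : ℕ) → EdgeColouring n → Set
IsIntervalColouring n t α =
  IsEdgeFunction α
  × (∀ v i → 1 ≤ α v i × α v i ≤ t)
  × (∀ c → 1 ≤ c → c ≤ t → ∃[ v ] ∃[ i ] (α v i ≡ c))
  × (∀ v i j → i ≢ j → α v i ≢ α v j)
  × (∀ v → ∃[ a ] ((∀ i → a ≤ α v i × α v i < a + n)
                  × (∀ k → k < n → ∃[ i ] (α v i ≡ a + k))))

HasIntervalColouring : ℕ → ℕ → Set
HasIntervalColouring n t = ∃[ α ] IsIntervalColouring n t α

IsW : ℕ → ℕ → Set
IsW n t = HasIntervalColouring n t × (∀ t′ → HasIntervalColouring n t′ → t′ ≤ t)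

span : ℕ → ℕ → ℕ
span a b = (a ∸ b) + (b ∸ a)

-- The span of two colours of an interval t-colouring is at most t − 1, so the
-- corollary follows from the upper bound  W(Q_n) ≤ n(n+1)/2, i.e. from
--
--   every interval t-colouring α of Q_n (n ≥ 1) has  t ≤ n(n+1)/2.
--
-- Write low(v) for the least colour at vertex v; the colours at v are then
-- exactly low(v), …, low(v) + n − 1.  If x and y differ in h coordinates,
-- those h directions carry h distinct colours below low(x) + n, so one of
-- them has colour at most low(x) + n − h (a pigeonhole count).  Crossing that
-- edge gives a neighbour x′, one step closer to y, with low(x′) ≤ low(x) + n − h.
-- Iterating,  low(y) ≤ low(x) + S(n,h)  where  S(n,h) = (n−1) + … + (n−h).
-- Starting at the endpoint x of the colour-1 edge that agrees with y in that
-- edge's direction (so low(x) ≤ 1 and h ≤ n−1) and taking y on the colour-t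
-- edge gives  t ≤ low(y) + n − 1 ≤ n + S(n,n−1) = n(n+1)/2.
module Submission where

open import Defs
open import Data.Nat using (ℕ; suc; _+_; _*_; _∸_; _≤_)
open import Data.Nat.DivMod using (_/_)
open import Data.Fin using (Fin)

open import Data.Nat using (zero; _<_; z≤n; s≤s; _≤?_)
open import Data.Nat.Properties
open import Data.Nat.DivMod using (m*n/n≡m)
open import Data.Nat.Tactic.RingSolver using (solve-∀)
open import Data.Bool using (Bool; true; false; not)
open import Data.Bool.Properties using (¬-not) renaming (_≟_ to _≟ᵇ_)
import Data.Fin as F
open import Data.Fin.Properties using (any?)
open import Data.Vec using (Vec; []; _∷_; lookup; replicate)
open import Data.Vec.Properties using (lookup∘updateAt; lookup∘updateAt′)
open import Data.Product using (∃-syntax; _×_; _,_; proj₁; proj₂)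
open import Data.Sum using (inj₁; inj₂)
open import Data.Empty using (⊥-elim)
open import Relation.Nullary using (Dec; yes; no; ¬?)
open import Relation.Nullary.Decidable using (_×-dec_)
open import Relation.Binary.PropositionalEquality
  using (_≡_; _≢_; ≢-sym; refl; sym; trans; cong; cong₂; subst; module ≡-Reasoning)

lookup-flip-same : ∀ {n} (i : Fin n) (x : Vertex n) → lookup (flip i x) i ≡ not (lookup x i)
lookup-flip-same i x = lookup∘updateAt i x

lookup-flip-other : ∀ {n} (i j : Fin n) (x : Vertex n) → i ≢ j → lookup (flip i x) j ≡ lookup x j
lookup-flip-other i j x i≢j = lookup∘updateAt′ j i (λ j≡i → i≢j (sym j≡i)) x

Differ : ∀ {n} → Vertex n → Vertex n → Fin n → Set
Differ x y i = lookup x i ≢ lookup y i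

differ? : ∀ {n} (x y : Vertex n) (i : Fin n) → Dec (Differ x y i)
differ? x y i = ¬? (lookup x i ≟ᵇ lookup y i)

differ-after-flip : ∀ {n} (i j : Fin n) (x y : Vertex n) → Differ x y i
  → Differ (flip i x) y j → i ≢ j × Differ x y j
differ-after-flip i j x y xi≢yi fxj≢yj with i F.≟ j
... | yes refl = ⊥-elim (fxj≢yj (trans (lookup-flip-same i x) (sym (¬-not (≢-sym xi≢yi)))))
... | no i≢j = i≢j , λ xj≡yj → fxj≢yj (trans (lookup-flip-other i j x i≢j) xj≡yj)

mismatch : Bool → Bool → ℕ
mismatch true  true  = 0
mismatch false false = 0
mismatch true  false = 1
mismatch false true  = 1

mismatch≤1 : ∀ a b → mismatch a b ≤ 1
mismatch≤1 true  true  = z≤n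
mismatch≤1 false false = z≤n
mismatch≤1 true  false = s≤s z≤n
mismatch≤1 false true  = s≤s z≤n

mismatch-refl : ∀ a → mismatch a a ≡ 0
mismatch-refl true  = refl
mismatch-refl false = refl

hamming : ∀ {n} → Vertex n → Vertex n → ℕ
hamming []      []      = 0
hamming (a ∷ x) (b ∷ y) = mismatch a b + hamming x y

hamming≤n : ∀ {n} (x y : Vertex n) → hamming x y ≤ n
hamming≤n []      []      = z≤n
hamming≤n (a ∷ x) (b ∷ y) = +-mono-≤ (mismatch≤1 a b) (hamming≤n x y)

hamming<n : ∀ {n} (i : Fin n) (x y : Vertex n) → lookup x i ≡ lookup y i → hamming x y < n
hamming<n F.zero    (a ∷ x) (.a ∷ y) refl rewrite mismatch-refl a = s≤s (hamming≤n x y)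
hamming<n (F.suc i) (a ∷ x) (b ∷ y) xi≡yi =
  s≤s (≤-trans (+-monoˡ-≤ (hamming x y) (mismatch≤1 a b)) (hamming<n i x y xi≡yi))

hamming-agree : ∀ {n} (x y : Vertex n) → (∀ i → lookup x i ≡ lookup y i) → hamming x y ≡ 0
hamming-agree []      []      _     = refl
hamming-agree (a ∷ x) (b ∷ y) agree with agree F.zero
... | refl rewrite mismatch-refl a = hamming-agree x y (λ i → agree (F.suc i))

hamming≡0⇒≡ : ∀ {n} (x y : Vertex n) → hamming x y ≡ 0 → x ≡ y
hamming≡0⇒≡ []      []      _ = refl
hamming≡0⇒≡ (a ∷ x) (b ∷ y) h≡0 =
  cong₂ _∷_ (same a b (m+n≡0⇒m≡0 (mismatch a b) h≡0)) (hamming≡0⇒≡ x y (m+n≡0⇒n≡0 (mismatch a b) h≡0))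
  where
  same : ∀ a b → mismatch a b ≡ 0 → a ≡ b
  same true  true  _ = refl
  same false false _ = refl
  same true  false ()
  same false true  ()

hamming-flip : ∀ {n} (i : Fin n) (x y : Vertex n) → Differ x y i
  → suc (hamming (flip i x) y) ≡ hamming x y
hamming-flip F.zero (true  ∷ x) (true  ∷ y) x≢y = ⊥-elim (x≢y refl)
hamming-flip F.zero (true  ∷ x) (false ∷ y) _   = refl
hamming-flip F.zero (false ∷ x) (true  ∷ y) _   = refl
hamming-flip F.zero (false ∷ x) (false ∷ y) x≢y = ⊥-elim (x≢y refl)
hamming-flip (F.suc i) (a ∷ x) (b ∷ y) x≢y =
  trans (sym (+-suc (mismatch a b) _)) (cong (mismatch a b +_) (hamming-flip i x y x≢y))

Injective : ∀ {n} → (Fin n → ℕ) → Set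
Injective f = ∀ i j → f i ≡ f j → i ≡ j

hamming-≤-window : ∀ b {n} (x y : Vertex n) (f : Fin n → ℕ) → Injective f → ∀ c
  → (∀ i → Differ x y i → c ≤ f i × f i < b) → hamming x y ≤ b ∸ c
hamming-≤-window zero x y f _ c window =
  subst (_≤ 0 ∸ c) (sym (hamming-agree x y agree)) z≤n
  where
  agree : ∀ i → lookup x i ≡ lookup y i
  agree i with lookup x i ≟ᵇ lookup y i
  ... | yes xi≡yi = xi≡yi
  ... | no xi≢yi with () ← proj₂ (window i xi≢yi)
hamming-≤-window (suc b) x y f inj c window
  with any? (λ i → differ? x y i ×-dec (f i ≟ b))
... | yes (i , xi≢yi , fi≡b) = begin
    hamming x y              ≡⟨ sym (hamming-flip i x y xi≢yi) ⟩
    suc (hamming (flip i x) y) ≤⟨ s≤s (hamming-≤-window b (flip i x) y f inj c window′) ⟩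
    suc (b ∸ c)              ≡⟨ sym (+-∸-assoc 1 c≤b) ⟩
    suc b ∸ c                ∎
  where
  open ≤-Reasoning
  c≤b : c ≤ b
  c≤b = subst (c ≤_) fi≡b (proj₁ (window i xi≢yi))
  -- the top label b belonged to coordinate i, which no longer differs
  window′ : ∀ j → Differ (flip i x) y j → c ≤ f j × f j < b
  window′ j fxj≢yj with differ-after-flip i j x y xi≢yi fxj≢yj
  ... | i≢j , xj≢yj with window j xj≢yj
  ... | c≤fj , fj<1+b =
    c≤fj , ≤∧≢⇒< (≤-pred fj<1+b) (λ fj≡b → i≢j (inj i j (trans fi≡b (sym fj≡b))))
... | no noneAtTop =
  ≤-trans (hamming-≤-window b x y f inj c window′) (∸-monoˡ-≤ c (n≤1+n b))
  where
  window′ : ∀ j → Differ x y j → c ≤ f j × f j < b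
  window′ j xj≢yj with window j xj≢yj
  ... | c≤fj , fj<1+b = c≤fj , ≤∧≢⇒< (≤-pred fj<1+b) (λ fj≡b → noneAtTop (j , xj≢yj , fj≡b))

cheap-differing-coordinate : ∀ {n} (x y : Vertex n) (f : Fin n → ℕ) → Injective f
  → ∀ a h → (∀ i → a ≤ f i × f i < a + n) → hamming x y ≡ suc h
  → ∃[ i ] (Differ x y i × f i + suc h ≤ a + n)
cheap-differing-coordinate {n} x y f inj a h range dist
  with any? (λ i → differ? x y i ×-dec (f i + suc h ≤? a + n))
... | yes found = found
... | no none = ⊥-elim (1+n≰n (begin
    suc h                           ≡⟨ sym dist ⟩
    hamming x y                     ≤⟨ hamming-≤-window (a + n) x y f inj (a + n ∸ h) expensive ⟩
    a + n ∸ (a + n ∸ h)             ≡⟨ m∸[m∸n]≡n h≤a+n ⟩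
    h                               ∎))
  where
  open ≤-Reasoning
  h≤a+n : h ≤ a + n
  h≤a+n = ≤-trans (n≤1+n h) (≤-trans (≤-reflexive (sym dist)) (≤-trans (hamming≤n x y) (m≤n+m n a)))
  -- otherwise all h + 1 differing labels lie in the window [a + n − h , a + n)
  expensive : ∀ i → Differ x y i → a + n ∸ h ≤ f i × f i < a + n
  expensive i xi≢yi = m≤n+o⇒m∸n≤o (a + n) h a+n≤h+fi , proj₂ (range i)
    where
    a+n≤h+fi : a + n ≤ h + f i
    a+n≤h+fi = ≤-pred (subst (suc (a + n) ≤_) (trans (+-suc (f i) h) (cong suc (+-comm (f i) h)))
                 (≰⇒> (λ le → none (i , xi≢yi , le))))

descentSum : ℕ → ℕ → ℕ
descentSum n zero    = 0
descentSum n (suc h) = (n ∸ suc h) + descentSum n h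

descentSum-mono : ∀ n {h k} → h ≤ k → descentSum n h ≤ descentSum n k
descentSum-mono n {zero}  z≤n = z≤n
descentSum-mono n {suc h} {suc k} (s≤s h≤k) with m≤n⇒m<n∨m≡n h≤k
... | inj₂ refl = ≤-refl
... | inj₁ h<k  = ≤-trans (descentSum-mono n h<k) (m≤n+m (descentSum n k) (n ∸ suc k))

descentSum-closed : ∀ n h → h ≤ n → descentSum n h * 2 + h * suc h ≡ h * n * 2
descentSum-closed n zero    _     = refl
descentSum-closed n (suc h) 1+h≤n = begin
    (k + s) * 2 + suc h * suc (suc h)     ≡⟨ regroup k s h ⟩
    (k + suc h) * 2 + (s * 2 + h * suc h) ≡⟨ cong₂ (λ m r → m * 2 + r) (m∸n+n≡m 1+h≤n)
                                               (descentSum-closed n h (≤-trans (n≤1+n h) 1+h≤n)) ⟩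
    n * 2 + h * n * 2                     ≡⟨ collect n h ⟩
    suc h * n * 2                         ∎
  where
  open ≡-Reasoning
  k s : ℕ
  k = n ∸ suc h
  s = descentSum n h
  regroup : ∀ k s h → (k + s) * 2 + suc h * suc (suc h) ≡ (k + suc h) * 2 + (s * 2 + h * suc h)
  regroup = solve-∀
  collect : ∀ n h → n * 2 + h * n * 2 ≡ suc h * n * 2
  collect = solve-∀

triangular : ∀ m → (suc m * (suc m + 1)) / 2 ≡ suc m + descentSum (suc m) m
triangular m = begin
    (suc m * (suc m + 1)) / 2  ≡⟨ cong (_/ 2) (sym doubled) ⟩
    (suc m + s) * 2 / 2        ≡⟨ m*n/n≡m (suc m + s) 2 ⟩
    suc m + s                  ∎
  where
  open ≡-Reasoning
  s : ℕ
  s = descentSum (suc m) m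
  twice-s : s * 2 ≡ m * suc m
  twice-s = +-cancelʳ-≡ (m * suc m) (s * 2) (m * suc m)
    (trans (descentSum-closed (suc m) m (n≤1+n m)) (double (m * suc m)))
    where
    double : ∀ a → a * 2 ≡ a + a
    double = solve-∀
  doubled : (suc m + s) * 2 ≡ suc m * (suc m + 1)
  doubled = begin
    (suc m + s) * 2        ≡⟨ *-distribʳ-+ 2 (suc m) s ⟩
    suc m * 2 + s * 2      ≡⟨ cong (suc m * 2 +_) twice-s ⟩
    suc m * 2 + m * suc m  ≡⟨ factor m ⟩
    suc m * (suc m + 1)    ∎
    where
    factor : ∀ m → suc m * 2 + m * suc m ≡ suc m * (suc m + 1)
    factor = solve-∀

module IntervalColouring {n t : ℕ} {α : EdgeColouring n} (col : IsIntervalColouring n t α) where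

  edge-function : IsEdgeFunction α
  edge-function = proj₁ col

  colour-range : ∀ v i → 1 ≤ α v i × α v i ≤ t
  colour-range = proj₁ (proj₂ col)

  every-colour-used : ∀ c → 1 ≤ c → c ≤ t → ∃[ v ] ∃[ i ] (α v i ≡ c)
  every-colour-used = proj₁ (proj₂ (proj₂ col))

  -- the least colour at v, and the interval [low v , low v + n) it starts
  low : Vertex n → ℕ
  low v = proj₁ (proj₂ (proj₂ (proj₂ (proj₂ col))) v)

  in-interval : ∀ v i → low v ≤ α v i × α v i < low v + n
  in-interval v = proj₁ (proj₂ (proj₂ (proj₂ (proj₂ (proj₂ col))) v))

  colours-injective : ∀ v → Injective (α v)
  colours-injective v i j αi≡αj with i F.≟ j
  ... | yes i≡j = i≡j
  ... | no  i≢j = ⊥-elim (proj₁ (proj₂ (proj₂ (proj₂ col))) v i j i≢j αi≡αj)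

  -- both endpoints of an edge see its colour, so their least colours are below it
  low-≤-edge : ∀ x i z → IsEnd x i z → low z ≤ α x i
  low-≤-edge x i .x          (inj₁ refl) = proj₁ (in-interval x i)
  low-≤-edge x i .(flip i x) (inj₂ refl) =
    subst (low (flip i x) ≤_) (sym (edge-function x i)) (proj₁ (in-interval (flip i x) i))

  -- Walking from x towards y along cheap edges:  low y ≤ low x + S(n, d(x,y)).
  low-growth : ∀ h (x y : Vertex n) → hamming x y ≡ h → low y ≤ low x + descentSum n h
  low-growth zero x y dist rewrite hamming≡0⇒≡ x y dist = m≤m+n (low y) 0
  low-growth (suc h) x y dist
    with cheap-differing-coordinate x y (α x) (colours-injective x) (low x) h (in-interval x) dist
  ... | i , xi≢yi , cheap = begin
      low y                                          ≤⟨ low-growth h (flip i x) y closer ⟩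
      low (flip i x) + descentSum n h                ≤⟨ +-monoˡ-≤ _ (low-≤-edge x i (flip i x) (inj₂ refl)) ⟩
      α x i + descentSum n h                         ≤⟨ +-monoˡ-≤ _ αxi≤ ⟩
      low x + (n ∸ suc h) + descentSum n h           ≡⟨ +-assoc (low x) (n ∸ suc h) (descentSum n h) ⟩
      low x + descentSum n (suc h)                   ∎
    where
    open ≤-Reasoning
    closer : hamming (flip i x) y ≡ h
    closer = suc-injective (trans (hamming-flip i x y xi≢yi) dist)
    αxi≤ : α x i ≤ low x + (n ∸ suc h)
    αxi≤ = subst (α x i ≤_) (+-∸-assoc (low x) (subst (_≤ n) dist (hamming≤n x y)))
             (m+n≤o⇒m≤o∸n (α x i) cheap)

  endpoint-agreeing : ∀ x i (y : Vertex n) → ∃[ z ] (IsEnd x i z × lookup z i ≡ lookup y i)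
  endpoint-agreeing x i y with lookup x i ≟ᵇ lookup y i
  ... | yes xi≡yi = x , inj₁ refl , xi≡yi
  ... | no  xi≢yi = flip i x , inj₂ refl , trans (lookup-flip-same i x) (sym (¬-not (≢-sym xi≢yi)))

module _ (m : ℕ) {t : ℕ} {α : EdgeColouring (suc m)} (col : IsIntervalColouring (suc m) t α) where
  open IntervalColouring col

  -- some colour is used, since Q_(m+1) has an edge
  one-≤-colours : 1 ≤ t
  one-≤-colours with colour-range (replicate (suc m) false) F.zero
  ... | 1≤c , c≤t = ≤-trans 1≤c c≤t

  colours-bound : t ≤ suc m + descentSum (suc m) m
  colours-bound with every-colour-used 1 ≤-refl one-≤-colours | every-colour-used t one-≤-colours ≤-refl
  ... | x₁ , i , αx₁i≡1 | y , j , αy≡t with endpoint-agreeing x₁ i y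
  ... | z , z-end , zi≡yi = ≤-pred (begin
      suc t                                  ≡⟨ cong suc (sym αy≡t) ⟩
      suc (α y j)                            ≤⟨ proj₂ (in-interval y j) ⟩
      low y + suc m                          ≤⟨ +-monoˡ-≤ (suc m) low-y ⟩
      suc (descentSum (suc m) m) + suc m     ≡⟨ cong suc (+-comm (descentSum (suc m) m) (suc m)) ⟩
      suc (suc m + descentSum (suc m) m)     ∎)
    where
    open ≤-Reasoning
    -- walk to y from the endpoint z of the colour-1 edge, at distance ≤ m
    low-y : low y ≤ 1 + descentSum (suc m) m
    low-y = ≤-trans (low-growth (hamming z y) z y refl)
      (+-mono-≤ (subst (low z ≤_) αx₁i≡1 (low-≤-edge x₁ i z z-end))
                (descentSum-mono (suc m) (≤-pred (hamming<n i z y zi≡yi))))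

span-≤ : ∀ {a b t} → 1 ≤ a × a ≤ t → 1 ≤ b × b ≤ t → span a b ≤ t ∸ 1
span-≤ {a} {b} (1≤a , a≤t) (1≤b , b≤t) with ≤-total a b
... | inj₁ a≤b rewrite m≤n⇒m∸n≡0 a≤b = ∸-mono b≤t 1≤a
... | inj₂ b≤a rewrite m≤n⇒m∸n≡0 b≤a | +-identityʳ (a ∸ b) = ∸-mono a≤t 1≤b

-- Corollary 6: sp_{α,n−1} ≤ n(n+1)/2 − 1.  The bound holds for the span of
-- any two edges of any interval colouring.
corollary6 : ∀ (n : ℕ) → 1 ≤ n → ∀ (t : ℕ) → IsW n t
  → ∀ (α : EdgeColouring n) → IsIntervalColouring n t α
  → ∀ (v : Vertex n) (i : Fin n) (w : Vertex n) (j : Fin n)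
  → EdgeDist v i w j (n ∸ 1)
  → span (α v i) (α w j) ≤ (n * (n + 1)) / 2 ∸ 1
corollary6 (suc m) _ t _ α col v i w j _ = begin
    span (α v i) (α w j)             ≤⟨ span-≤ (colour-range v i) (colour-range w j) ⟩
    t ∸ 1                            ≤⟨ ∸-monoˡ-≤ 1 (colours-bound m col) ⟩
    suc m + descentSum (suc m) m ∸ 1 ≡⟨ cong (_∸ 1) (sym (triangular m)) ⟩
    (suc m * (suc m + 1)) / 2 ∸ 1    ∎
  where
  open ≤-Reasoning
  open IntervalColouring col using (colour-range)
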